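{- For all integers $n, r \geq 0$ and $k \geq 1$, \[ G(n,k,r) = F(n+1-kr,k-1,r). \]
   Context: A composition of $n$ is a finite sequence of positive integers summing to $n$. $G(n,k,r)$ is the number of compositions of $n$ all of whose parts are at most $k$ and exactly $r$ of whose parts equal $k$ (for $r\ge1$: compositions of $n$ with largest part $k$ occurring exactly $r$ times). For integers $k\ge0$: $F(n,k)=0$ for $n\le0$, $F(1,k)=1$, $F(n,k)=\sum_{i=1}^kF(n-i,k)$ for $n\ge2$. For $r\ge0$, $F(n+1,k,r)$ is the coefficient of $x^n$ in $\left(\sum_{i\ge0}F(i+1,k)x^i\right)^{r+1}$ for $n\ge0$, and $F(n,k,r)=0$ for $n\le0$. -}

module Defs where

open import Data.Nat using (ℕ; zero; suc; _+_; _*_; _∸_; _≤_; _≟_)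
open import Data.List using (List; []; _∷_; take; length; filter)
open import Data.Nat.ListAction using (sum)
open import Data.List.Relation.Unary.All using (All)
open import Data.Product using (Σ; _×_)
open import Relation.Binary.PropositionalEquality using (_≡_)

-- [F(n,k), F(n-1,k), ..., F(1,k)]  (descending), recursion of the paper:
-- F(1,k)=1, F(n,k) = Σ_{i=1}^k F(n-i,k) for n ≥ 2, with F(m,k)=0 for m ≤ 0.
Fs : ℕ → ℕ → List ℕ
Fs zero k = []
Fs (suc zero) k = 1 ∷ []
Fs (suc (suc m)) k = sum (take k (Fs (suc m) k)) ∷ Fs (suc m) k

headOr0 : List ℕ → ℕ
headOr0 [] = 0
headOr0 (x ∷ _) = x

F : ℕ → ℕ → ℕ
F n k = headOr0 (Fs n k)

-- power series over ℕ as coefficient functions; Cauchy product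
Σ≤ : ℕ → (ℕ → ℕ) → ℕ
Σ≤ zero f = f 0
Σ≤ (suc n) f = Σ≤ n f + f (suc n)

conv : (ℕ → ℕ) → (ℕ → ℕ) → (ℕ → ℕ)
conv a b n = Σ≤ n (λ j → a j * b (n ∸ j))

pow1+ : (ℕ → ℕ) → ℕ → (ℕ → ℕ)
pow1+ a zero = a
pow1+ a (suc r) = conv a (pow1+ a r)

-- F(n,k,r): F(n+1,k,r) = [x^n] (Σ_{i≥0} F(i+1,k) x^i)^{r+1}, F(0,k,r) = 0
F3 : ℕ → ℕ → ℕ → ℕ
F3 zero k r = 0
F3 (suc n) k r = pow1+ (λ i → F (suc i) k) r n

IsComposition : ℕ → List ℕ → Set
IsComposition n c = All (1 ≤_) c × sum c ≡ n

countEq : ℕ → List ℕ → ℕ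
countEq k c = length (filter (_≟ k) c)

-- the set whose cardinality is G(n,k,r): compositions of n with all parts ≤ k
-- and exactly r parts equal to k
GSet : ℕ → ℕ → ℕ → Set
GSet n k r = Σ (List ℕ) (λ c → IsComposition n c × All (_≤ k) c × countEq k c ≡ r)

-- Write the bound of the statement as K = 1+k.  A composition of n with parts
-- ≤ K and exactly r parts equal to K is cut at its r occurrences of K into r+1
-- blocks, each a composition with parts ≤ k, whose sizes add up to m = n - K*r
-- (and no such composition exists when n < K*r).  On the other side,
-- F(m+1,k,r) is the m-th coefficient of the (r+1)-st power of Σ F(i+1,k) x^i,
-- and the m-th coefficient of a product counts pairs (block of size j, block
-- of size m-j).
module Submission where

open import Defs
open import Data.Nat using (ℕ; zero; suc; _+_; _*_; _∸_; _≤_; _<_; z≤n; s≤s; s≤s⁻¹; _≟_; _≤?_)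
open import Data.Nat.Properties
open import Data.Nat.Tactic.RingSolver using (solve-∀)
open import Data.Nat.ListAction using (sum)
open import Data.Nat.ListAction.Properties using (sum-++)
open import Data.Fin using (Fin)
open import Data.Fin.Properties using (+↔⊎; *↔×; 1↔⊤)
open import Data.List using (List; []; _∷_; _++_; take; length)
open import Data.List.Properties using (filter-accept; filter-reject; take-[]; ∷-injectiveˡ; ∷-injectiveʳ)
open import Data.List.Relation.Unary.All as All using (All; []; _∷_)
open import Data.List.Relation.Unary.All.Properties using (++⁺; ++⁻ˡ; ++⁻ʳ)
open import Data.Product using (Σ; _×_; _,_; proj₁; proj₂)
open import Data.Product.Algebra using (×-cong)
open import Data.Product.Function.Dependent.Propositional using (Σ-↔)
open import Data.Sum using (_⊎_; inj₁; inj₂)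
open import Data.Sum.Algebra using (⊎-cong)
open import Data.Unit using (⊤; tt)
open import Data.Empty using (⊥-elim)
open import Function.Bundles using (_↔_; mk↔ₛ′)
open import Function.Properties.Inverse using (↔-refl; ↔-sym; ↔-trans)
open import Function.Related.Propositional using (module EquationalReasoning)
open import Relation.Nullary using (yes; no; ¬_)
open import Relation.Nullary.Irrelevant using (Irrelevant)
open import Relation.Binary.PropositionalEquality

Σ-≡-irrelevant : {A : Set} {P : A → Set} → (∀ {a} → Irrelevant (P a)) →
                 {x y : Σ A P} → proj₁ x ≡ proj₁ y → x ≡ y
Σ-≡-irrelevant irr {a , p} {.a , q} refl = cong (a ,_) (irr p q)

×-irrelevant : {A B : Set} → Irrelevant A → Irrelevant B → Irrelevant (A × B)
×-irrelevant irrA irrB (a , b) (a′ , b′) = cong₂ _,_ (irrA a a′) (irrB b b′)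

drop-proof : {P A : Set} → P → Irrelevant P → (P × A) ↔ A
drop-proof p irr = mk↔ₛ′ proj₂ (p ,_) (λ _ → refl) (λ (q , a) → cong (_, a) (irr p q))

_⊛_ : (ℕ → Set) → (ℕ → Set) → ℕ → Set
(S ⊛ T) m = Σ ℕ (λ j → j ≤ m × S j × T (m ∸ j))

⊛-cong : {S S′ T T′ : ℕ → Set} → (∀ j → S j ↔ S′ j) → (∀ j → T j ↔ T′ j) →
         ∀ m → (S ⊛ T) m ↔ (S′ ⊛ T′) m
⊛-cong f g m = Σ-↔ ↔-refl (λ {j} → ×-cong ↔-refl (×-cong (f j) (g (m ∸ j))))

⊛-zero : (S T : ℕ → Set) → (S ⊛ T) 0 ↔ (S 0 × T 0)
⊛-zero S T = mk↔ₛ′ (λ { (0 , z≤n , st) → st }) (λ st → 0 , z≤n , st)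
                   (λ _ → refl) (λ { (0 , z≤n , st) → refl })

⊛-suc : (S T : ℕ → Set) (m : ℕ) →
        (S ⊛ T) (suc m) ↔ ((S 0 × T (suc m)) ⊎ ((λ j → S (suc j)) ⊛ T) m)
⊛-suc S T m = mk↔ₛ′ split join split-join join-split
  where
  split : (S ⊛ T) (suc m) → (S 0 × T (suc m)) ⊎ ((λ j → S (suc j)) ⊛ T) m
  split (zero , _ , st) = inj₁ st
  split (suc j , s≤s j≤m , st) = inj₂ (j , j≤m , st)
  join : (S 0 × T (suc m)) ⊎ ((λ j → S (suc j)) ⊛ T) m → (S ⊛ T) (suc m)
  join (inj₁ st) = 0 , z≤n , st
  join (inj₂ (j , j≤m , st)) = suc j , s≤s j≤m , st
  split-join : ∀ y → split (join y) ≡ y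
  split-join (inj₁ _) = refl
  split-join (inj₂ _) = refl
  join-split : ∀ x → join (split x) ≡ x
  join-split (zero , z≤n , _) = refl
  join-split (suc j , s≤s _ , _) = refl

Σ≤-cons : (n : ℕ) (f : ℕ → ℕ) → Σ≤ (suc n) f ≡ f 0 + Σ≤ n (λ j → f (suc j))
Σ≤-cons zero f = refl
Σ≤-cons (suc n) f = trans (cong (_+ f (suc (suc n))) (Σ≤-cons n f)) (+-assoc (f 0) _ _)

finConv : (a b : ℕ → ℕ) (m : ℕ) →
          Fin (conv a b m) ↔ ((λ j → Fin (a j)) ⊛ (λ j → Fin (b j))) m
finConv a b zero = ↔-trans *↔× (↔-sym (⊛-zero (λ j → Fin (a j)) (λ j → Fin (b j))))
finConv a b (suc m) = begin
  Fin (conv a b (suc m))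
    ≡⟨ cong Fin (Σ≤-cons m (λ j → a j * b (suc m ∸ j))) ⟩
  Fin (a 0 * b (suc m) + conv (λ j → a (suc j)) b m)
    ↔⟨ +↔⊎ ⟩
  (Fin (a 0 * b (suc m)) ⊎ Fin (conv (λ j → a (suc j)) b m))
    ↔⟨ ⊎-cong *↔× (finConv (λ j → a (suc j)) b m) ⟩
  ((Fin (a 0) × Fin (b (suc m))) ⊎ ((λ j → Fin (a (suc j))) ⊛ (λ j → Fin (b j))) m)
    ↔⟨ ⊛-suc (λ j → Fin (a j)) (λ j → Fin (b j)) m ⟨
  ((λ j → Fin (a j)) ⊛ (λ j → Fin (b j))) (suc m) ∎
  where open EquationalReasoning

Blocks : (ℕ → Set) → ℕ → ℕ → Set
Blocks S zero = S
Blocks S (suc r) = S ⊛ Blocks S r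

finPow : (a : ℕ → ℕ) (S : ℕ → Set) → (∀ m → Fin (a m) ↔ S m) →
         ∀ r m → Fin (pow1+ a r m) ↔ Blocks S r m
finPow a S count zero m = count m
finPow a S count (suc r) m =
  ↔-trans (finConv a (pow1+ a r) m) (⊛-cong count (finPow a S count r) m)

Comp : ℕ → ℕ → Set
Comp k m = Σ (List ℕ) (λ c → IsComposition m c × All (_≤ k) c)

IsComposition-irrelevant : ∀ {m c} → Irrelevant (IsComposition m c)
IsComposition-irrelevant = ×-irrelevant (All.irrelevant ≤-irrelevant) ≡-irrelevant

Comp-≡ : ∀ {k m} {x y : Comp k m} → proj₁ x ≡ proj₁ y → x ≡ y
Comp-≡ = Σ-≡-irrelevant (×-irrelevant IsComposition-irrelevant (All.irrelevant ≤-irrelevant))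

Comp-zero : ∀ k → Comp k 0 ↔ ⊤
Comp-zero k = mk↔ₛ′ (λ _ → tt) (λ _ → [] , ([] , refl) , []) (λ _ → refl) empty-unique
  where
  empty-unique : ∀ x → ([] , ([] , refl) , []) ≡ x
  empty-unique ([] , _) = Comp-≡ refl
  empty-unique ((_ ∷ _) , ((s≤s z≤n ∷ _) , ()) , _)

Comp-head : ∀ k m → Comp k (suc m) ↔ ((_< k) ⊛ Comp k) m
Comp-head k m = mk↔ₛ′ split join split-join join-split
  where
  split : Comp k (suc m) → ((_< k) ⊛ Comp k) m
  split ([] , (_ , ()) , _)
  split ((suc p ∷ c) , ((s≤s z≤n ∷ positive) , total) , (p<k ∷ bounded)) =
    p , p≤m , p<k , c , (positive , rest) , bounded
    where
    p+c≡m : p + sum c ≡ m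
    p+c≡m = suc-injective total
    p≤m : p ≤ m
    p≤m = subst (p ≤_) p+c≡m (m≤m+n p (sum c))
    rest : sum c ≡ m ∸ p
    rest = trans (sym (m+n∸m≡n p (sum c))) (cong (_∸ p) p+c≡m)
  join : ((_< k) ⊛ Comp k) m → Comp k (suc m)
  join (p , p≤m , p<k , c , (positive , rest) , bounded) =
    (suc p ∷ c) , ((s≤s z≤n ∷ positive) , cong suc (trans (cong (p +_) rest) (m+[n∸m]≡n p≤m)))
                , (p<k ∷ bounded)
  split-join : ∀ y → split (join y) ≡ y
  split-join (p , _ , p<k , _) =
    cong (λ (le , cp) → p , le , p<k , cp) (cong₂ _,_ (≤-irrelevant _ _) (Comp-≡ refl))
  join-split : ∀ x → join (split x) ≡ x
  join-split ([] , (_ , ()) , _)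
  join-split ((suc _ ∷ _) , ((s≤s z≤n ∷ _) , _) , (_ ∷ _)) = Comp-≡ refl

count-comp : ∀ k m → Fin (F (suc m) k) ↔ Comp k m
count-heads : ∀ k t m → Fin (sum (take t (Fs (suc m) k))) ↔ ((_< t) ⊛ Comp k) m

count-comp k zero = ↔-trans 1↔⊤ (↔-sym (Comp-zero k))
count-comp k (suc m) = ↔-trans (count-heads k k m) (↔-sym (Comp-head k m))

count-heads k zero m =
  mk↔ₛ′ (λ ()) (λ { (_ , _ , () , _) }) (λ { (_ , _ , () , _) }) (λ ())
count-heads k (suc t) zero = begin
  Fin (1 + sum (take t []))           ≡⟨ cong (λ l → Fin (1 + sum l)) (take-[] t) ⟩
  Fin (F 1 k)                         ↔⟨ count-comp k zero ⟩
  Comp k 0                            ↔⟨ drop-proof (s≤s z≤n) ≤-irrelevant ⟨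
  (0 < suc t × Comp k 0)              ↔⟨ ⊛-zero (_< suc t) (Comp k) ⟨
  ((_< suc t) ⊛ Comp k) 0             ∎
  where open EquationalReasoning
count-heads k (suc t) (suc m) = begin
  Fin (F (suc (suc m)) k + sum (take t (Fs (suc m) k)))
    ↔⟨ +↔⊎ ⟩
  (Fin (F (suc (suc m)) k) ⊎ Fin (sum (take t (Fs (suc m) k))))
    ↔⟨ ⊎-cong (count-comp k (suc m)) (count-heads k t m) ⟩
  (Comp k (suc m) ⊎ ((_< t) ⊛ Comp k) m)
    ↔⟨ ⊎-cong (↔-sym (drop-proof (s≤s z≤n) ≤-irrelevant)) (⊛-cong {T = Comp k} suc<suc (λ _ → ↔-refl) m) ⟩
  ((0 < suc t × Comp k (suc m)) ⊎ ((λ p → suc p < suc t) ⊛ Comp k) m)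
    ↔⟨ ⊛-suc (_< suc t) (Comp k) m ⟨
  ((_< suc t) ⊛ Comp k) (suc m) ∎
  where
  open EquationalReasoning
  suc<suc : ∀ p → p < t ↔ suc p < suc t
  suc<suc p = mk↔ₛ′ s≤s s≤s⁻¹ (λ { (s≤s _) → refl }) (λ _ → refl)

countEq-≡ : ∀ {K x} c → x ≡ K → countEq K (x ∷ c) ≡ suc (countEq K c)
countEq-≡ {K} c x≡K = cong length (filter-accept (_≟ K) x≡K)

countEq-≢ : ∀ {K x} c → ¬ x ≡ K → countEq K (x ∷ c) ≡ countEq K c
countEq-≢ {K} c x≢K = cong length (filter-reject (_≟ K) x≢K)

K*countEq≤sum : ∀ K c → K * countEq K c ≤ sum c
K*countEq≤sum K [] = ≤-reflexive (*-zeroʳ K)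
K*countEq≤sum K (x ∷ c) with x ≟ K
... | yes refl = begin
  K * countEq K (K ∷ c)   ≡⟨ cong (K *_) (countEq-≡ c refl) ⟩
  K * suc (countEq K c)   ≡⟨ *-suc K _ ⟩
  K + K * countEq K c     ≤⟨ +-monoʳ-≤ K (K*countEq≤sum K c) ⟩
  K + sum c               ∎
  where open ≤-Reasoning
... | no x≢K = begin
  K * countEq K (x ∷ c)   ≡⟨ cong (K *_) (countEq-≢ c x≢K) ⟩
  K * countEq K c         ≤⟨ K*countEq≤sum K c ⟩
  sum c                   ≤⟨ m≤n+m (sum c) x ⟩
  x + sum c               ∎
  where open ≤-Reasoning

countEq-free : ∀ {K c} → All (λ x → ¬ x ≡ K) c → countEq K c ≡ 0
countEq-free [] = refl
countEq-free {c = _ ∷ c} (x≢K ∷ free) = trans (countEq-≢ c x≢K) (countEq-free free)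

countEq-zero⇒free : ∀ {K} c → countEq K c ≡ 0 → All (λ x → ¬ x ≡ K) c
countEq-zero⇒free [] _ = []
countEq-zero⇒free {K} (x ∷ c) none with x ≟ K
... | yes x≡K with () ← trans (sym (countEq-≡ c x≡K)) none
... | no x≢K = x≢K ∷ countEq-zero⇒free c (trans (sym (countEq-≢ c x≢K)) none)

countEq-++ : ∀ {K c₁} c₂ → All (λ x → ¬ x ≡ K) c₁ → countEq K (c₁ ++ K ∷ c₂) ≡ suc (countEq K c₂)
countEq-++ c₂ [] = countEq-≡ c₂ refl
countEq-++ {c₁ = _ ∷ c₁} c₂ (x≢K ∷ free) = trans (countEq-≢ (c₁ ++ _ ∷ c₂) x≢K) (countEq-++ c₂ free)

first-occurrence : ∀ {K r} c → countEq K c ≡ suc r →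
  Σ (List ℕ × List ℕ) (λ (c₁ , c₂) → All (λ x → ¬ x ≡ K) c₁ × c ≡ c₁ ++ K ∷ c₂)
first-occurrence [] ()
first-occurrence {K} (x ∷ c) count with x ≟ K
... | yes x≡K = ([] , c) , [] , cong (_∷ c) x≡K
... | no x≢K with first-occurrence c (trans (sym (countEq-≢ c x≢K)) count)
...   | (c₁ , c₂) , free , c≡ = (x ∷ c₁ , c₂) , x≢K ∷ free , cong (x ∷_) c≡

first-occurrence-unique : ∀ {K : ℕ} {c₁ c₂ d₁ d₂ : List ℕ} →
  All (λ x → ¬ x ≡ K) c₁ → All (λ x → ¬ x ≡ K) d₁ →
  c₁ ++ K ∷ c₂ ≡ d₁ ++ K ∷ d₂ → (c₁ , c₂) ≡ (d₁ , d₂)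
first-occurrence-unique [] [] eq = cong ([] ,_) (∷-injectiveʳ eq)
first-occurrence-unique [] (K≢K ∷ _) eq = ⊥-elim (K≢K (sym (∷-injectiveˡ eq)))
first-occurrence-unique (K≢K ∷ _) [] eq = ⊥-elim (K≢K (∷-injectiveˡ eq))
first-occurrence-unique (_ ∷ free) (_ ∷ free′) eq =
  cong₂ (λ x (c₁ , c₂) → x ∷ c₁ , c₂) (∷-injectiveˡ eq)
        (first-occurrence-unique free free′ (∷-injectiveʳ eq))

left-comm : ∀ a b c → a + (b + c) ≡ b + (a + c)
left-comm = solve-∀

cut-arithmetic : ∀ a b m x y → a + (y + b) ≡ m + (y + x) → x ≤ b → a ≤ m × b ≡ m ∸ a + x
cut-arithmetic a b m x y sizes x≤b = a≤m , b≡m∸a+x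
  where
  a+b≡m+x : a + b ≡ m + x
  a+b≡m+x = +-cancelˡ-≡ y _ _ (trans (left-comm y a b) (trans sizes (left-comm m y x)))
  a≤m : a ≤ m
  a≤m = +-cancelʳ-≤ x a m (subst (a + x ≤_) a+b≡m+x (+-monoʳ-≤ a x≤b))
  b≡m∸a+x : b ≡ m ∸ a + x
  b≡m∸a+x = trans (sym (m+n∸m≡n a b)) (trans (cong (_∸ a) a+b≡m+x) (+-∸-comm x a≤m))

glue-arithmetic : ∀ j m x y → j ≤ m → j + (y + (m ∸ j + x)) ≡ m + (y + x)
glue-arithmetic j m x y j≤m =
  trans (regroup j y (m ∸ j) x) (cong (_+ (y + x)) (m+[n∸m]≡n j≤m))
  where
  regroup : ∀ a b c d → a + (b + (c + d)) ≡ (a + c) + (b + d)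
  regroup = solve-∀

module _ (k : ℕ) where

  private
    K : ℕ
    K = suc k

  bounded⇒free : ∀ {c} → All (_≤ k) c → All (λ x → ¬ x ≡ K) c
  bounded⇒free = All.map (λ x≤k x≡K → 1+n≰n (subst (_≤ k) x≡K x≤k))

  bounded∧free⇒bounded : ∀ {c} → All (_≤ K) c → All (λ x → ¬ x ≡ K) c → All (_≤ k) c
  bounded∧free⇒bounded bounded free =
    All.zipWith (λ (x≤K , x≢K) → s≤s⁻¹ (≤∧≢⇒< x≤K x≢K)) (bounded , free)

  GSet-≡ : ∀ {n r} {x y : GSet n K r} → proj₁ x ≡ proj₁ y → x ≡ y
  GSet-≡ = Σ-≡-irrelevant (×-irrelevant IsComposition-irrelevant
                             (×-irrelevant (All.irrelevant ≤-irrelevant) ≡-irrelevant))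

  GSet-zero : ∀ m → GSet m K 0 ↔ Comp k m
  GSet-zero m = mk↔ₛ′
    (λ (c , comp , bounded , none) → c , comp , bounded∧free⇒bounded bounded (countEq-zero⇒free c none))
    (λ (c , comp , bounded) → c , comp , All.map m≤n⇒m≤1+n bounded , countEq-free (bounded⇒free bounded))
    (λ _ → Comp-≡ refl) (λ _ → GSet-≡ refl)

  -- What remains after the first K of an element of GSet (m + K * suc r) K (suc r).
  Rest : ℕ → ℕ → Set
  Rest r u = GSet (u + K * r) K r

  pieces : ∀ {r m} → (Comp k ⊛ Rest r) m → List ℕ × List ℕ
  pieces (_ , _ , (c₁ , _) , (c₂ , _)) = c₁ , c₂

  pieces-≡ : ∀ {r m} {x y : (Comp k ⊛ Rest r) m} → pieces x ≡ pieces y → x ≡ y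
  pieces-≡ {x = _ , j≤m , (c₁ , (pos , refl) , bounded) , (c₂ , props)}
           {y = _ , j≤m′ , (_ , (pos′ , refl) , bounded′) , (_ , props′)} refl =
    cong₂ (λ le ((p , b) , rest) → sum c₁ , le , (c₁ , (p , refl) , b) , rest)
      (≤-irrelevant j≤m j≤m′)
      (cong₂ _,_ (cong₂ _,_ (All.irrelevant ≤-irrelevant pos pos′)
                            (All.irrelevant ≤-irrelevant bounded bounded′))
                 (GSet-≡ {x = c₂ , props} {y = c₂ , props′} refl))

  -- Cutting at the first K: the part before it is K-free, i.e. has parts ≤ k.
  GSet-cut : ∀ r m → GSet (m + K * suc r) K (suc r) ↔ (Comp k ⊛ Rest r) m
  GSet-cut r m = mk↔ₛ′ cut glue cut-glue glue-cut
    where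
    IsG : List ℕ → Set
    IsG c = IsComposition (m + K * suc r) c × All (_≤ K) c × countEq K c ≡ suc r

    cut-at : ∀ c₁ c₂ → All (λ x → ¬ x ≡ K) c₁ → IsG (c₁ ++ K ∷ c₂) → (Comp k ⊛ Rest r) m
    cut-at c₁ c₂ free ((pos , total) , bounded , count) =
      sum c₁ , proj₁ sizes , (c₁ , (++⁻ˡ c₁ pos , refl) , bounded∧free⇒bounded (++⁻ˡ c₁ bounded) free)
             , (c₂ , (All.tail (++⁻ʳ c₁ pos) , proj₂ sizes) , All.tail (++⁻ʳ c₁ bounded) , count₂)
      where
      count₂ : countEq K c₂ ≡ r
      count₂ = suc-injective (trans (sym (countEq-++ c₂ free)) count)
      total′ : sum c₁ + (K + sum c₂) ≡ m + (K + K * r)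
      total′ = trans (sym (sum-++ c₁ (K ∷ c₂))) (trans total (cong (m +_) (*-suc K r)))
      sizes : sum c₁ ≤ m × sum c₂ ≡ m ∸ sum c₁ + K * r
      sizes = cut-arithmetic (sum c₁) (sum c₂) m (K * r) K total′
                (subst (λ z → K * z ≤ sum c₂) count₂ (K*countEq≤sum K c₂))

    cut : GSet (m + K * suc r) K (suc r) → (Comp k ⊛ Rest r) m
    cut (c , props) =
      let ((c₁ , c₂) , free , c≡) = first-occurrence c (proj₂ (proj₂ props))
      in cut-at c₁ c₂ free (subst IsG c≡ props)

    glue : (Comp k ⊛ Rest r) m → GSet (m + K * suc r) K (suc r)
    glue (j , j≤m , (c₁ , (pos₁ , size₁) , bounded₁) , (c₂ , (pos₂ , size₂) , bounded₂ , count₂)) =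
      c₁ ++ K ∷ c₂ , (++⁺ pos₁ (s≤s z≤n ∷ pos₂) , total)
                   , ++⁺ (All.map m≤n⇒m≤1+n bounded₁) (≤-refl ∷ bounded₂)
                   , trans (countEq-++ c₂ (bounded⇒free bounded₁)) (cong suc count₂)
      where
      open ≡-Reasoning
      total : sum (c₁ ++ K ∷ c₂) ≡ m + K * suc r
      total = begin
        sum (c₁ ++ K ∷ c₂)          ≡⟨ sum-++ c₁ (K ∷ c₂) ⟩
        sum c₁ + (K + sum c₂)       ≡⟨ cong₂ (λ a b → a + (K + b)) size₁ size₂ ⟩
        j + (K + (m ∸ j + K * r))   ≡⟨ glue-arithmetic j m (K * r) K j≤m ⟩
        m + (K + K * r)             ≡⟨ cong (m +_) (*-suc K r) ⟨
        m + K * suc r               ∎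

    cut-glue : ∀ y → cut (glue y) ≡ y
    cut-glue y@(_ , _ , (c₁ , _ , bounded₁) , (c₂ , _)) =
      let (_ , free , c≡) = first-occurrence (c₁ ++ K ∷ c₂) (proj₂ (proj₂ (proj₂ (glue y))))
      in pieces-≡ (sym (first-occurrence-unique (bounded⇒free bounded₁) free c≡))

    glue-cut : ∀ x → glue (cut x) ≡ x
    glue-cut (c , props) = GSet-≡ (sym (proj₂ (proj₂ (first-occurrence c (proj₂ (proj₂ props))))))

  GSet-blocks : ∀ r m → GSet (m + K * r) K r ↔ Blocks (Comp k) r m
  GSet-blocks zero m = begin
    GSet (m + K * 0) K 0   ≡⟨ cong (λ n → GSet n K 0) (trans (cong (m +_) (*-zeroʳ K)) (+-identityʳ m)) ⟩
    GSet m K 0             ↔⟨ GSet-zero m ⟩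
    Comp k m               ∎
    where open EquationalReasoning
  GSet-blocks (suc r) m =
    ↔-trans (GSet-cut r m) (⊛-cong {T = Rest r} (λ _ → ↔-refl) (GSet-blocks r) m)

GSet-empty : ∀ {n K r} → n < K * r → ¬ GSet n K r
GSet-empty {K = K} n<Kr (c , (_ , total) , _ , count) =
  <⇒≱ n<Kr (subst₂ (λ u v → K * u ≤ v) count total (K*countEq≤sum K c))

empty↔Fin0 : {A : Set} → ¬ A → A ↔ Fin 0
empty↔Fin0 ¬a = mk↔ₛ′ (λ a → ⊥-elim (¬a a)) (λ ()) (λ ()) (λ a → ⊥-elim (¬a a))

mainTheorem13 : (n k r : ℕ) → 1 ≤ k →
    GSet n k r ↔ Fin (F3 (n + 1 ∸ k * r) (k ∸ 1) r)
mainTheorem13 n zero r ()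
mainTheorem13 n (suc k) r _ with suc k * r ≤? n
... | yes Kr≤n = begin
  GSet n (suc k) r                         ≡⟨ cong (λ n → GSet n (suc k) r) (sym (m∸n+n≡m Kr≤n)) ⟩
  GSet (m + suc k * r) (suc k) r           ↔⟨ GSet-blocks k r m ⟩
  Blocks (Comp k) r m                      ↔⟨ finPow (λ i → F (suc i) k) (Comp k) (count-comp k) r m ⟨
  Fin (F3 (suc m) k r)                     ≡⟨ cong (λ z → Fin (F3 z k r)) n+1∸Kr≡1+m ⟨
  Fin (F3 (n + 1 ∸ suc k * r) k r)         ∎
  where
  open EquationalReasoning
  m : ℕ
  m = n ∸ suc k * r
  n+1∸Kr≡1+m : n + 1 ∸ suc k * r ≡ suc m
  n+1∸Kr≡1+m = trans (+-∸-comm 1 Kr≤n) (+-comm m 1)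
... | no Kr≰n = begin
  GSet n (suc k) r                         ↔⟨ empty↔Fin0 (GSet-empty (≰⇒> Kr≰n)) ⟩
  Fin 0                                    ≡⟨ cong (λ z → Fin (F3 z k r)) n+1∸Kr≡0 ⟨
  Fin (F3 (n + 1 ∸ suc k * r) k r)         ∎
  where
  open EquationalReasoning
  n+1∸Kr≡0 : n + 1 ∸ suc k * r ≡ 0
  n+1∸Kr≡0 = m≤n⇒m∸n≡0 (subst (_≤ suc k * r) (+-comm 1 n) (≰⇒> Kr≰n))
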